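{- Let $\mathcal C$ be a minimal vertex cover of $G$. For each $x_i\in\mathcal C$ choose an edge $y_{r_i}$ with $y_{r_i}\cap\mathcal C=\{x_i\}$, let $W$ be the set of endpoints of the chosen edges that lie outside $\mathcal C$, and define $\tilde e(\mathcal C)=\sum_{x_i\in\mathcal C}(v_{r_i},1)+\sum_{x_j\notin\mathcal C\cup W}(e_j,1)+e_{n+1}$. Then $\tilde e(\mathcal C)\in\mathbb{N}B\cap(\mathbb{R}_+B)^\circ$.
   Context: $G$ is a connected simple graph with $V(G)=\{x_1,\dots,x_n\}$, $E(G)=\{y_1,\dots,y_q\}\neq\emptyset$. A vertex cover is a set of vertices meeting every edge; minimal is with respect to inclusion (so such edges $y_{r_i}$ exist). $e_1,\dots,e_n$ is the canonical basis of $\mathbb{R}^n$, $v_k=e_i+e_j$ the characteristic vector of $y_k=\{x_i,x_j\}$, $e_{n+1}=(0,\dots,0,1)\in\mathbb{R}^{n+1}$, $B=\{(e_1,1),\dots,(e_n,1),(v_1,1),\dots,(v_q,1),e_{n+1}\}$, $\mathbb{N}B$ and $\mathbb{R}_+B$ the nonnegative integer resp. real combinations of $B$, $(\mathbb{R}_+B)^\circ$ the interior of $\mathbb{R}_+B$ in $\mathbb{R}^{n+1}$.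
   Formalization: The interior $(\mathbb{R}_+B)^\circ$ is taken over ℚ: the box around $\tilde e(\mathcal C)$ has rational radius, is tested at rational points, and cone membership uses nonnegative rational combinations of $B$. -}

module Defs where

open import Data.Nat as ℕ using (ℕ; zero; suc)
open import Data.Rational as ℚ using (ℚ; 0ℚ; 1ℚ; ∣_∣)
import Data.Integer as ℤ
open import Data.Fin using (Fin; zero; suc; _≟_)
open import Data.Bool using (Bool; true; false; if_then_else_; _∧_; _∨_; not)
open import Data.Product using (Σ; ∃; _×_; _,_; proj₁; proj₂)
open import Data.Sum using (_⊎_)
open import Relation.Binary.PropositionalEquality using (_≡_; _≢_)
open import Relation.Nullary.Decidable using (⌊_⌋)
open import Relation.Binary.Construct.Closure.ReflexiveTransitive using (Star)

-- Graphs: V(G) = {x_0,...,x_{n-1}} ≅ Fin n, E(G) = {y_0,...,y_{q-1}} ≅ Fin q.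
-- Edge k has endpoints (end₁ k, end₂ k).

record Graph (n q : ℕ) : Set where
  field
    end₁ end₂ : Fin q → Fin n

_∈E_ : {n q : ℕ} → Fin n → (G : Graph n q) → Fin q → Set
(j ∈E G) k = Graph.end₁ G k ≡ j ⊎ Graph.end₂ G k ≡ j

inc : {n q : ℕ} → Graph n q → Fin q → Fin n → Bool
inc G k j = ⌊ Graph.end₁ G k ≟ j ⌋ ∨ ⌊ Graph.end₂ G k ≟ j ⌋

Adj : {n q : ℕ} → Graph n q → Fin n → Fin n → Set
Adj G i j = ∃ λ k → (Graph.end₁ G k ≡ i × Graph.end₂ G k ≡ j)
                  ⊎ (Graph.end₁ G k ≡ j × Graph.end₂ G k ≡ i)

IsSimple : {n q : ℕ} → Graph n q → Set
IsSimple {n} {q} G =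
  (∀ k → Graph.end₁ G k ≢ Graph.end₂ G k) ×
  (∀ k l → (∀ j → (j ∈E G) k → (j ∈E G) l) → (∀ j → (j ∈E G) l → (j ∈E G) k) → k ≡ l)

IsConnected : {n q : ℕ} → Graph n q → Set
IsConnected G = ∀ i j → Star (Adj G) i j

IsVertexCover : {n q : ℕ} → Graph n q → (Fin n → Bool) → Set
IsVertexCover G C = ∀ k → C (Graph.end₁ G k) ≡ true ⊎ C (Graph.end₂ G k) ≡ true

IsMinimalVertexCover : {n q : ℕ} → Graph n q → (Fin n → Bool) → Set
IsMinimalVertexCover {n} G C =
  IsVertexCover G C ×
  ((D : Fin n → Bool) → (∀ i → D i ≡ true → C i ≡ true) → IsVertexCover G D →
     ∀ i → C i ≡ true → D i ≡ true)

-- Points of A^{n+1} written as (u , t) with u ∈ A^n and t the last coordinate.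

Point : Set → ℕ → Set
Point A n = (Fin n → A) × A

sumFin : {A : Set} → (A → A → A) → A → (n : ℕ) → (Fin n → A) → A
sumFin _⊕_ z zero    f = z
sumFin _⊕_ z (suc n) f = f zero ⊕ sumFin _⊕_ z n (λ i → f (suc i))

_+P_ : {n : ℕ} → Point ℕ n → Point ℕ n → Point ℕ n
(u , s) +P (v , t) = (λ j → u j ℕ.+ v j) , s ℕ.+ t

0P : {n : ℕ} → Point ℕ n
0P = (λ _ → 0) , 0

ΣP : {n : ℕ} (m : ℕ) → (Fin m → Point ℕ n) → Point ℕ n
ΣP m f = sumFin _+P_ 0P m f

_·P_ : {n : ℕ} → ℕ → Point ℕ n → Point ℕ n
c ·P (u , t) = (λ j → c ℕ.* u j) , c ℕ.* t

_≈P_ : {A : Set} {n : ℕ} → Point A n → Point A n → Set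
(u , s) ≈P (v , t) = (∀ j → u j ≡ v j) × s ≡ t

δ : {n : ℕ} → Fin n → Fin n → ℕ
δ i j = if ⌊ i ≟ j ⌋ then 1 else 0

eB : {n : ℕ} → Fin n → Point ℕ n
eB i = δ i , 1

vB : {n q : ℕ} → Graph n q → Fin q → Point ℕ n
vB G k = (λ j → δ (Graph.end₁ G k) j ℕ.+ δ (Graph.end₂ G k) j) , 1

eLast : {n : ℕ} → Point ℕ n
eLast = (λ _ → 0) , 1

combℕ : {n q : ℕ} → Graph n q → (Fin n → ℕ) → (Fin q → ℕ) → ℕ → Point ℕ n
combℕ {n} {q} G a b c =
  (ΣP n (λ i → a i ·P eB i) +P ΣP q (λ k → b k ·P vB G k)) +P (c ·P eLast)

In-ℕB : {n q : ℕ} → Graph n q → Point ℕ n → Set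
In-ℕB {n} {q} G x = Σ (Fin n → ℕ) λ a → Σ (Fin q → ℕ) λ b → Σ ℕ λ c → combℕ G a b c ≈P x

toℚP : {n : ℕ} → Point ℕ n → Point ℚ n
toℚP (u , t) = (λ j → ℤ.+ (u j) ℚ./ 1) , ℤ.+ t ℚ./ 1

_+Q_ : {n : ℕ} → Point ℚ n → Point ℚ n → Point ℚ n
(u , s) +Q (v , t) = (λ j → u j ℚ.+ v j) , s ℚ.+ t

0Q : {n : ℕ} → Point ℚ n
0Q = (λ _ → 0ℚ) , 0ℚ

ΣQ : {n : ℕ} (m : ℕ) → (Fin m → Point ℚ n) → Point ℚ n
ΣQ m f = sumFin _+Q_ 0Q m f

_·Q_ : {n : ℕ} → ℚ → Point ℚ n → Point ℚ n
c ·Q (u , t) = (λ j → c ℚ.* u j) , c ℚ.* t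

combℚ : {n q : ℕ} → Graph n q → (Fin n → ℚ) → (Fin q → ℚ) → ℚ → Point ℚ n
combℚ {n} {q} G a b c =
  (ΣQ n (λ i → a i ·Q toℚP (eB i)) +Q ΣQ q (λ k → b k ·Q toℚP (vB G k)))
    +Q (c ·Q toℚP eLast)

In-ℚ₊B : {n q : ℕ} → Graph n q → Point ℚ n → Set
In-ℚ₊B {n} {q} G x =
  Σ (Fin n → ℚ) λ a → Σ (Fin q → ℚ) λ b → Σ ℚ λ c →
    (∀ i → 0ℚ ℚ.≤ a i) × (∀ k → 0ℚ ℚ.≤ b k) × (0ℚ ℚ.≤ c) × combℚ G a b c ≈P x

-- x ∈ (ℝ₊B)° , tested on rational points: some open sup-norm box of rational
-- radius ε > 0 around x has all its rational points in the cone.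
In-Interior : {n q : ℕ} → Graph n q → Point ℚ n → Set
In-Interior {n} {q} G x =
  Σ ℚ λ ε → 0ℚ ℚ.< ε ×
    ((y : Point ℚ n) → (∀ j → ∣ proj₁ y j ∣ ℚ.< ε) → ∣ proj₂ y ∣ ℚ.< ε →
       In-ℚ₊B G (x +Q y))

-- The vector ẽ(C), given C and the choice i ↦ r i (only used for i ∈ C).

anyFin : (n : ℕ) → (Fin n → Bool) → Bool
anyFin n f = sumFin _∨_ false n f

inW : {n q : ℕ} → Graph n q → (Fin n → Bool) → (Fin n → Fin q) → Fin n → Bool
inW {n} G C r j = not (C j) ∧ anyFin n (λ i → C i ∧ inc G (r i) j)

ẽ : {n q : ℕ} → Graph n q → (Fin n → Bool) → (Fin n → Fin q) → Point ℕ n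
ẽ {n} G C r =
  (ΣP n (λ i → if C i then vB G (r i) else 0P)
   +P ΣP n (λ j → if not (C j) ∧ not (inW G C r j) then eB j else 0P))
   +P eLast

{-# OPTIONS --safe #-}
module Submission where

-- ẽ(C) is by construction an ℕ-combination of B in which e_{n+1} occurs, and each of its
-- coordinates is at least 1: a vertex of C lies on its chosen edge, a vertex of W on the chosen
-- edge of some vertex of C, and every other vertex contributes its own e_j.  Such a lattice point
-- a + V + c e_{n+1} of ℕB (V the edge part, c ≥ 1) is interior: with s = 1/(1 + |V|), keep only
-- the fraction 1 - s of the edge part and move s V into the vertex part.  Every vertex
-- coefficient is then at least s, and the remaining e_{n+1}-coefficient is at least
-- c - s |V| ≥ 1 - s |V| = s.  A perturbation of sup-norm below s/(n+1) changes each of these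
-- coefficients by less than s, so none becomes negative.

open import Defs
open import Data.Nat using (ℕ; _≥_)
open import Data.Fin using (Fin)
open import Data.Bool using (Bool; true)
open import Data.Product using (_×_)
open import Relation.Binary.PropositionalEquality using (_≡_)

open import Algebra.Bundles using (CommutativeMonoid; CommutativeRing)
import Algebra.Properties.CommutativeMonoid.Sum as CommutativeMonoidSum
import Algebra.Properties.Semiring.Sum as SemiringSum
open import Data.Bool using (false; if_then_else_; _∧_; _∨_; not)
open import Data.Empty using (⊥-elim)
open import Data.Fin using (zero; suc; _≟_; punchIn)
open import Data.Fin.Properties using (punchInᵢ≢i)
import Data.Integer as ℤ
import Data.Integer.Properties as ℤ
open import Data.Nat as ℕ using (zero; suc; _≤_; z≤n; s≤s)
import Data.Nat.Properties as ℕ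
open import Data.Product using (∃; _,_; proj₁; proj₂)
open import Data.Rational as ℚ using (ℚ; 0ℚ; 1ℚ; ∣_∣)
import Data.Rational.Properties as ℚ
open import Data.Rational.Solver using (module +-*-Solver)
import Data.Rational.Unnormalised as ℚᵘ
import Data.Rational.Unnormalised.Properties as ℚᵘ
open import Data.Sum using (inj₁; inj₂)
open import Data.Vec.Functional as Vector using (Vector)
open import Function using (_∘_)
open import Relation.Binary.PropositionalEquality
  using (_≢_; refl; sym; trans; cong; cong₂; subst; module ≡-Reasoning)
open import Relation.Nullary using (yes; no)
open import Relation.Nullary.Decidable using (⌊_⌋)

open +-*-Solver
open CommutativeRing ℚ.+-*-commutativeRing using () renaming (semiring to ℚ-semiring)
open import Algebra.Properties.Group ℚ.+-0-group using (⁻¹-involutive)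

module ℕΣ = SemiringSum ℕ.+-*-semiring
module ℚΣ = SemiringSum ℚ-semiring

sumℕ : {n : ℕ} → (Fin n → ℕ) → ℕ
sumℕ = ℕΣ.sum

sumℚ : {n : ℕ} → (Fin n → ℚ) → ℚ
sumℚ = ℚΣ.sum

sumFin-homo : {A B : Set} {_⊕_ : A → A → A} {z : A} {_⊗_ : B → B → B} {z′ : B}
  (h : A → B) → (∀ x y → h (x ⊕ y) ≡ h x ⊗ h y) → h z ≡ z′ →
  ∀ m (f : Fin m → A) → h (sumFin _⊕_ z m f) ≡ Vector.foldr _⊗_ z′ (h ∘ f)
sumFin-homo h homo h-z zero    f = h-z
sumFin-homo {_⊗_ = _⊗_} h homo h-z (suc m) f =
  trans (homo _ _) (cong (h (f zero) ⊗_) (sumFin-homo h homo h-z m (f ∘ suc)))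

module _ {c ℓ} (M : CommutativeMonoid c ℓ) where
  open CommutativeMonoid M renaming (_∙_ to _+_; ε to 0#; ∙-congˡ to +-congˡ; identityʳ to +-identityʳ)
  open CommutativeMonoidSum M
  open import Relation.Binary.Reasoning.Setoid setoid

  sum-supported-at : ∀ {n} (f : Vector Carrier n) j → (∀ i → i ≢ j → f i ≈ 0#) → sum f ≈ f j
  sum-supported-at {suc n} f j off = begin
    sum f                              ≈⟨ sum-remove f ⟩
    f j + sum (Vector.removeAt f j)    ≈⟨ +-congˡ (sum-cong-≋ (λ i → off (punchIn j i) (punchInᵢ≢i j i))) ⟩
    f j + sum (Vector.replicate n 0#)  ≈⟨ +-congˡ (sum-replicate-zero n) ⟩
    f j + 0#                           ≈⟨ +-identityʳ (f j) ⟩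
    f j                                ∎

sumℕ-term≤ : ∀ {n} (f : Fin n → ℕ) i → f i ≤ sumℕ f
sumℕ-term≤ f zero    = ℕ.m≤m+n _ _
sumℕ-term≤ f (suc i) = ℕ.≤-trans (sumℕ-term≤ (f ∘ suc) i) (ℕ.m≤n+m _ _)

fromℕ : ℕ → ℚ
fromℕ k = ℤ.+ k ℚ./ 1

toℚᵘ-fromℕ : ∀ k → ℚ.toℚᵘ (fromℕ k) ℚᵘ.≃ ℚᵘ.mkℚᵘ (ℤ.+ k) 0
toℚᵘ-fromℕ k = ℚ.toℚᵘ-fromℚᵘ (ℚᵘ.mkℚᵘ (ℤ.+ k) 0)

fromℕ-homo-+ : ∀ a b → fromℕ (a ℕ.+ b) ≡ fromℕ a ℚ.+ fromℕ b
fromℕ-homo-+ a b = ℚ.toℚᵘ-injective (begin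
  ℚ.toℚᵘ (fromℕ (a ℕ.+ b))
    ≈⟨ toℚᵘ-fromℕ (a ℕ.+ b) ⟩
  ℚᵘ.mkℚᵘ (ℤ.+ (a ℕ.+ b)) 0
    ≈⟨ ℚᵘ.*≡* (cong (ℤ._* ℤ.+ 1) (trans (ℤ.pos-+ a b)
                                                        (sym (cong₂ ℤ._+_ (ℤ.*-identityʳ (ℤ.+ a)) (ℤ.*-identityʳ (ℤ.+ b)))))) ⟩
  ℚᵘ.mkℚᵘ (ℤ.+ a) 0 ℚᵘ.+ ℚᵘ.mkℚᵘ (ℤ.+ b) 0
    ≈⟨ ℚᵘ.+-cong (toℚᵘ-fromℕ a) (toℚᵘ-fromℕ b) ⟨
  ℚ.toℚᵘ (fromℕ a) ℚᵘ.+ ℚ.toℚᵘ (fromℕ b)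
    ≈⟨ ℚ.toℚᵘ-homo-+ (fromℕ a) (fromℕ b) ⟨
  ℚ.toℚᵘ (fromℕ a ℚ.+ fromℕ b) ∎)
  where open ℚᵘ.≃-Reasoning

fromℕ-homo-* : ∀ a b → fromℕ (a ℕ.* b) ≡ fromℕ a ℚ.* fromℕ b
fromℕ-homo-* zero    b = sym (ℚ.*-zeroˡ (fromℕ b))
fromℕ-homo-* (suc a) b = begin
  fromℕ (b ℕ.+ a ℕ.* b)
    ≡⟨ fromℕ-homo-+ b (a ℕ.* b) ⟩
  fromℕ b ℚ.+ fromℕ (a ℕ.* b)
    ≡⟨ cong (fromℕ b ℚ.+_) (fromℕ-homo-* a b) ⟩
  fromℕ b ℚ.+ fromℕ a ℚ.* fromℕ b
    ≡⟨ solve 2 (λ a b → b :+ a :* b := (con 1ℚ :+ a) :* b) refl (fromℕ a) (fromℕ b) ⟩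
  (1ℚ ℚ.+ fromℕ a) ℚ.* fromℕ b
    ≡⟨ cong (ℚ._* fromℕ b) (fromℕ-homo-+ 1 a) ⟨
  fromℕ (suc a) ℚ.* fromℕ b ∎
  where open ≡-Reasoning

fromℕ-sum : ∀ {n} (f : Fin n → ℕ) → fromℕ (sumℕ f) ≡ sumℚ (fromℕ ∘ f)
fromℕ-sum {zero}  f = refl
fromℕ-sum {suc n} f =
  trans (fromℕ-homo-+ (f zero) (sumℕ (f ∘ suc))) (cong (fromℕ (f zero) ℚ.+_) (fromℕ-sum (f ∘ suc)))

sum-scaled-fromℕ : ∀ {m} c (f : Fin m → ℕ) → sumℚ (λ i → c ℚ.* fromℕ (f i)) ≡ c ℚ.* fromℕ (sumℕ f)
sum-scaled-fromℕ c f = trans (sym (ℚΣ.*-distribˡ-sum c (fromℕ ∘ f))) (cong (c ℚ.*_) (sym (fromℕ-sum f)))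

0≤fromℕ : ∀ k → 0ℚ ℚ.≤ fromℕ k
0≤fromℕ k = ℚ.nonNegative⁻¹ (fromℕ k) {{ℚ.normalize-nonNeg k 1}}

fromℕ-mono-≤ : ∀ {a b} → a ≤ b → fromℕ a ℚ.≤ fromℕ b
fromℕ-mono-≤ {a} {b} a≤b with ℕ.m≤n⇒∃[o]m+o≡n a≤b
... | d , refl = begin
  fromℕ a                   ≡⟨ ℚ.+-identityʳ (fromℕ a) ⟨
  fromℕ a ℚ.+ 0ℚ            ≤⟨ ℚ.+-monoʳ-≤ (fromℕ a) (0≤fromℕ d) ⟩
  fromℕ a ℚ.+ fromℕ d       ≡⟨ fromℕ-homo-+ a d ⟨
  fromℕ (a ℕ.+ d)           ∎
  where open ℚ.≤-Reasoning

fromℕ-suc-positive : ∀ k → ℚ.Positive (fromℕ (suc k))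
fromℕ-suc-positive k = ℚ.normalize-pos (suc k) 1

fromℕ-suc-nonZero : ∀ k → ℚ.NonZero (fromℕ (suc k))
fromℕ-suc-nonZero k = ℚ.pos⇒nonZero (fromℕ (suc k)) {{fromℕ-suc-positive k}}

recip : ℕ → ℚ
recip k = ℚ.1/_ (fromℕ (suc k)) {{fromℕ-suc-nonZero k}}

0<recip : ∀ k → 0ℚ ℚ.< recip k
0<recip k = ℚ.positive⁻¹ (recip k) {{ℚ.1/pos⇒pos (fromℕ (suc k)) {{fromℕ-suc-positive k}}}}

recip+recip*k≡1 : ∀ k → recip k ℚ.+ recip k ℚ.* fromℕ k ≡ 1ℚ
recip+recip*k≡1 k = begin
  recip k ℚ.+ recip k ℚ.* fromℕ k
    ≡⟨ solve 2 (λ r x → r :+ r :* x := r :* (con 1ℚ :+ x)) refl (recip k) (fromℕ k) ⟩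
  recip k ℚ.* (1ℚ ℚ.+ fromℕ k)
    ≡⟨ cong (recip k ℚ.*_) (fromℕ-homo-+ 1 k) ⟨
  recip k ℚ.* fromℕ (suc k)
    ≡⟨ ℚ.*-inverseˡ (fromℕ (suc k)) {{fromℕ-suc-nonZero k}} ⟩
  1ℚ ∎
  where open ≡-Reasoning

p≤∣p∣ : ∀ p → p ℚ.≤ ∣ p ∣
p≤∣p∣ p with ℚ.∣p∣≡p∨∣p∣≡-p p
... | inj₁ ∣p∣≡p  = ℚ.≤-reflexive (sym ∣p∣≡p)
... | inj₂ ∣p∣≡-p = begin
  p              ≡⟨ ⁻¹-involutive p ⟨
  ℚ.- (ℚ.- p)    ≤⟨ ℚ.neg-antimono-≤ (subst (0ℚ ℚ.≤_) ∣p∣≡-p (ℚ.0≤∣p∣ p)) ⟩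
  0ℚ             ≤⟨ ℚ.0≤∣p∣ p ⟩
  ∣ p ∣          ∎
  where open ℚ.≤-Reasoning

∣p∣≤q⇒-q≤p : ∀ {p q} → ∣ p ∣ ℚ.≤ q → ℚ.- q ℚ.≤ p
∣p∣≤q⇒-q≤p {p} {q} ∣p∣≤q = begin
  ℚ.- q          ≤⟨ ℚ.neg-antimono-≤ (ℚ.≤-trans (p≤∣p∣ (ℚ.- p)) (subst (ℚ._≤ q) (sym (ℚ.∣-p∣≡∣p∣ p)) ∣p∣≤q)) ⟩
  ℚ.- (ℚ.- p)    ≡⟨ ⁻¹-involutive p ⟩
  p              ∎
  where open ℚ.≤-Reasoning

p≤q⇒0≤q-p : ∀ {p q} → p ℚ.≤ q → 0ℚ ℚ.≤ q ℚ.- p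
p≤q⇒0≤q-p {p} {q} p≤q = subst (ℚ._≤ q ℚ.- p) (ℚ.+-inverseʳ p) (ℚ.+-monoˡ-≤ (ℚ.- p) p≤q)

p≤p+q : ∀ {p q} → 0ℚ ℚ.≤ q → p ℚ.≤ p ℚ.+ q
p≤p+q {p} {q} 0≤q = subst (ℚ._≤ p ℚ.+ q) (ℚ.+-identityʳ p) (ℚ.+-monoʳ-≤ p 0≤q)

p≤1⇒p*q≤q : ∀ {p q} → 0ℚ ℚ.≤ q → p ℚ.≤ 1ℚ → p ℚ.* q ℚ.≤ q
p≤1⇒p*q≤q {p} {q} 0≤q p≤1 =
  ℚ.≤-trans (ℚ.*-monoʳ-≤-nonNeg q {{ℚ.nonNegative 0≤q}} p≤1) (ℚ.≤-reflexive (ℚ.*-identityˡ q))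

0≤p*q : ∀ {p q} → 0ℚ ℚ.≤ p → 0ℚ ℚ.≤ q → 0ℚ ℚ.≤ p ℚ.* q
0≤p*q {p} {q} 0≤p 0≤q = ℚ.nonNegative⁻¹ (p ℚ.* q)
  {{ℚ.nonNeg*nonNeg⇒nonNeg p {{ℚ.nonNegative 0≤p}} q {{ℚ.nonNegative 0≤q}}}}

sumℚ≤fromℕ* : ∀ {n} (f : Fin n → ℚ) e → (∀ i → f i ℚ.≤ e) → sumℚ f ℚ.≤ fromℕ n ℚ.* e
sumℚ≤fromℕ* {zero}  f e f≤e = ℚ.≤-reflexive (sym (ℚ.*-zeroˡ e))
sumℚ≤fromℕ* {suc n} f e f≤e = begin
  f zero ℚ.+ sumℚ (f ∘ suc)     ≤⟨ ℚ.+-mono-≤ (f≤e zero) (sumℚ≤fromℕ* (f ∘ suc) e (f≤e ∘ suc)) ⟩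
  e ℚ.+ fromℕ n ℚ.* e           ≡⟨ solve 2 (λ e x → e :+ x :* e := (con 1ℚ :+ x) :* e) refl e (fromℕ n) ⟩
  (1ℚ ℚ.+ fromℕ n) ℚ.* e        ≡⟨ cong (ℚ._* e) (fromℕ-homo-+ 1 n) ⟨
  fromℕ (suc n) ℚ.* e           ∎
  where open ℚ.≤-Reasoning

δ-diag : ∀ {n} (i : Fin n) → δ i i ≡ 1
δ-diag i with i ≟ i
... | yes _   = refl
... | no i≢i  = ⊥-elim (i≢i refl)

δ-off : ∀ {n} {i j : Fin n} → i ≢ j → δ i j ≡ 0
δ-off {i = i} {j} i≢j with i ≟ j
... | yes i≡j = ⊥-elim (i≢j i≡j)
... | no _    = refl

sumℕ-δ : ∀ {n} (a : Fin n → ℕ) j → sumℕ (λ i → a i ℕ.* δ i j) ≡ a j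
sumℕ-δ a j = trans
  (sum-supported-at ℕ.+-0-commutativeMonoid _ j (λ i i≢j → trans (cong (a i ℕ.*_) (δ-off i≢j)) (ℕ.*-zeroʳ (a i))))
  (trans (cong (a j ℕ.*_) (δ-diag j)) (ℕ.*-identityʳ (a j)))

sumℚ-δ : ∀ {n} (a : Fin n → ℚ) j → sumℚ (λ i → a i ℚ.* fromℕ (δ i j)) ≡ a j
sumℚ-δ a j = trans
  (sum-supported-at ℚ.+-0-commutativeMonoid _ j
    (λ i i≢j → trans (cong (λ d → a i ℚ.* fromℕ d) (δ-off i≢j)) (ℚ.*-zeroʳ (a i))))
  (trans (cong (λ d → a j ℚ.* fromℕ d) (δ-diag j)) (ℚ.*-identityʳ (a j)))

pushforward : {n q : ℕ} → (Fin n → Fin q) → (Fin n → ℕ) → Fin q → ℕ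
pushforward r w k = sumℕ (λ i → w i ℕ.* δ (r i) k)

sum-pushforward : ∀ {n q} (r : Fin n → Fin q) w (g : Fin q → ℕ) →
  sumℕ (λ k → pushforward r w k ℕ.* g k) ≡ sumℕ (λ i → w i ℕ.* g (r i))
sum-pushforward r w g = begin
  sumℕ (λ k → pushforward r w k ℕ.* g k)
    ≡⟨ ℕΣ.sum-cong-≗ (λ k → ℕΣ.*-distribʳ-sum (g k) (λ i → w i ℕ.* δ (r i) k)) ⟩
  sumℕ (λ k → sumℕ (λ i → (w i ℕ.* δ (r i) k) ℕ.* g k))
    ≡⟨ ℕΣ.∑-comm (λ k i → (w i ℕ.* δ (r i) k) ℕ.* g k) ⟩
  sumℕ (λ i → sumℕ (λ k → (w i ℕ.* δ (r i) k) ℕ.* g k))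
    ≡⟨ ℕΣ.sum-cong-≗ concentrated ⟩
  sumℕ (λ i → w i ℕ.* g (r i))                                ∎
  where
  open ≡-Reasoning
  concentrated : ∀ i → sumℕ (λ k → (w i ℕ.* δ (r i) k) ℕ.* g k) ≡ w i ℕ.* g (r i)
  concentrated i = trans
    (sum-supported-at ℕ.+-0-commutativeMonoid _ (r i)
      (λ k k≢ri → cong (ℕ._* g k) (trans (cong (w i ℕ.*_) (δ-off (k≢ri ∘ sym))) (ℕ.*-zeroʳ (w i)))))
    (cong (ℕ._* g (r i)) (trans (cong (w i ℕ.*_) (δ-diag (r i))) (ℕ.*-identityʳ (w i))))

sum-pushforward-total : ∀ {n q} (r : Fin n → Fin q) w → sumℕ (pushforward r w) ≡ sumℕ w
sum-pushforward-total r w = begin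
  sumℕ (pushforward r w)                          ≡⟨ ℕΣ.sum-cong-≗ (λ k → ℕ.*-identityʳ (pushforward r w k)) ⟨
  sumℕ (λ k → pushforward r w k ℕ.* 1)            ≡⟨ sum-pushforward r w (λ _ → 1) ⟩
  sumℕ (λ i → w i ℕ.* 1)                          ≡⟨ ℕΣ.sum-cong-≗ (ℕ.*-identityʳ ∘ w) ⟩
  sumℕ w                                          ∎
  where open ≡-Reasoning

𝟙 : Bool → ℕ
𝟙 b = if b then 1 else 0

∨⇒1≤𝟙+𝟙 : ∀ b₁ b₂ → b₁ ∨ b₂ ≡ true → 1 ≤ 𝟙 b₁ ℕ.+ 𝟙 b₂
∨⇒1≤𝟙+𝟙 true  _    _ = s≤s z≤n
∨⇒1≤𝟙+𝟙 false true _ = s≤s z≤n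

∧-true⁻ : ∀ {b₁ b₂} → b₁ ∧ b₂ ≡ true → b₁ ≡ true × b₂ ≡ true
∧-true⁻ {true} {true} _ = refl , refl

anyFin-true : ∀ n (f : Fin n → Bool) → anyFin n f ≡ true → ∃ λ i → f i ≡ true
anyFin-true (suc n) f any with f zero in f0
... | true  = zero , f0
... | false with anyFin-true n (f ∘ suc) any
...   | i , fi = suc i , fi

ΣP-coord : ∀ {n} m (f : Fin m → Point ℕ n) j → proj₁ (ΣP m f) j ≡ sumℕ (λ i → proj₁ (f i) j)
ΣP-coord m f j = sumFin-homo (λ x → proj₁ x j) (λ _ _ → refl) refl m f

ΣP-last : ∀ {n} m (f : Fin m → Point ℕ n) → proj₂ (ΣP m f) ≡ sumℕ (λ i → proj₂ (f i))
ΣP-last m f = sumFin-homo proj₂ (λ _ _ → refl) refl m f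

ΣQ-coord : ∀ {n} m (f : Fin m → Point ℚ n) j → proj₁ (ΣQ m f) j ≡ sumℚ (λ i → proj₁ (f i) j)
ΣQ-coord m f j = sumFin-homo (λ x → proj₁ x j) (λ _ _ → refl) refl m f

ΣQ-last : ∀ {n} m (f : Fin m → Point ℚ n) → proj₂ (ΣQ m f) ≡ sumℚ (λ i → proj₂ (f i))
ΣQ-last m f = sumFin-homo proj₂ (λ _ _ → refl) refl m f

proj₁-if : ∀ {n} b (x : Point ℕ n) j → proj₁ (if b then x else 0P) j ≡ 𝟙 b ℕ.* proj₁ x j
proj₁-if true  x j = sym (ℕ.*-identityˡ _)
proj₁-if false x j = refl

proj₂-if : ∀ {n} b (x : Point ℕ n) → proj₂ (if b then x else 0P) ≡ 𝟙 b ℕ.* proj₂ x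
proj₂-if true  x = sym (ℕ.*-identityˡ _)
proj₂-if false x = refl

v : {n q : ℕ} → Graph n q → Fin q → Fin n → ℕ
v G k = proj₁ (vB G k)

edgeSumℕ : {n q : ℕ} → Graph n q → (Fin q → ℕ) → Fin n → ℕ
edgeSumℕ G b j = sumℕ (λ k → b k ℕ.* v G k j)

edgeSumℚ : {n q : ℕ} → Graph n q → (Fin q → ℚ) → Fin n → ℚ
edgeSumℚ G b j = sumℚ (λ k → b k ℚ.* fromℕ (v G k j))

module _ {n q : ℕ} (G : Graph n q) where

  ∈E⇒1≤v : ∀ {j k} → (j ∈E G) k → 1 ≤ v G k j
  ∈E⇒1≤v {j} (inj₁ e₁≡j) = ℕ.≤-trans (ℕ.≤-reflexive (sym (trans (cong (λ i → δ i j) e₁≡j) (δ-diag j)))) (ℕ.m≤m+n _ _)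
  ∈E⇒1≤v {j} (inj₂ e₂≡j) = ℕ.≤-trans (ℕ.≤-reflexive (sym (trans (cong (λ i → δ i j) e₂≡j) (δ-diag j)))) (ℕ.m≤n+m _ _)

  inc⇒1≤v : ∀ {j k} → inc G k j ≡ true → 1 ≤ v G k j
  inc⇒1≤v {j} {k} = ∨⇒1≤𝟙+𝟙 ⌊ Graph.end₁ G k ≟ j ⌋ ⌊ Graph.end₂ G k ≟ j ⌋

  combℕ-coord : ∀ a b c j → proj₁ (combℕ G a b c) j ≡ a j ℕ.+ edgeSumℕ G b j
  combℕ-coord a b c j = begin
    (proj₁ (ΣP n _) j ℕ.+ proj₁ (ΣP q _) j) ℕ.+ c ℕ.* 0
      ≡⟨ cong₂ ℕ._+_ (cong₂ ℕ._+_ (trans (ΣP-coord n _ j) (sumℕ-δ a j)) (ΣP-coord q _ j)) (ℕ.*-zeroʳ c) ⟩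
    (a j ℕ.+ edgeSumℕ G b j) ℕ.+ 0
      ≡⟨ ℕ.+-identityʳ _ ⟩
    a j ℕ.+ edgeSumℕ G b j ∎
    where open ≡-Reasoning

  combℕ-last : ∀ a b c → proj₂ (combℕ G a b c) ≡ (sumℕ a ℕ.+ sumℕ b) ℕ.+ c
  combℕ-last a b c = cong₂ ℕ._+_
    (cong₂ ℕ._+_ (trans (ΣP-last n _) (ℕΣ.sum-cong-≗ (ℕ.*-identityʳ ∘ a)))
                 (trans (ΣP-last q _) (ℕΣ.sum-cong-≗ (ℕ.*-identityʳ ∘ b))))
    (ℕ.*-identityʳ c)

  combℚ-coord : ∀ a b c j → proj₁ (combℚ G a b c) j ≡ a j ℚ.+ edgeSumℚ G b j
  combℚ-coord a b c j = begin
    (proj₁ (ΣQ n _) j ℚ.+ proj₁ (ΣQ q _) j) ℚ.+ c ℚ.* 0ℚ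
      ≡⟨ cong₂ ℚ._+_ (cong₂ ℚ._+_ (trans (ΣQ-coord n _ j) (sumℚ-δ a j)) (ΣQ-coord q _ j)) (ℚ.*-zeroʳ c) ⟩
    (a j ℚ.+ edgeSumℚ G b j) ℚ.+ 0ℚ
      ≡⟨ ℚ.+-identityʳ _ ⟩
    a j ℚ.+ edgeSumℚ G b j ∎
    where open ≡-Reasoning

  combℚ-last : ∀ a b c → proj₂ (combℚ G a b c) ≡ (sumℚ a ℚ.+ sumℚ b) ℚ.+ c
  combℚ-last a b c = cong₂ ℚ._+_
    (cong₂ ℚ._+_ (trans (ΣQ-last n _) (ℚΣ.sum-cong-≗ (ℚ.*-identityʳ ∘ a)))
                 (trans (ΣQ-last q _) (ℚΣ.sum-cong-≗ (ℚ.*-identityʳ ∘ b))))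
    (ℚ.*-identityʳ c)

  edgeSumℚ-fromℕ : ∀ c m j → edgeSumℚ G (λ k → c ℚ.* fromℕ (m k)) j ≡ c ℚ.* fromℕ (edgeSumℕ G m j)
  edgeSumℚ-fromℕ c m j = trans
    (ℚΣ.sum-cong-≗ (λ k → trans (ℚ.*-assoc c (fromℕ (m k)) _) (cong (c ℚ.*_) (sym (fromℕ-homo-* (m k) (v G k j))))))
    (sum-scaled-fromℕ c (λ k → m k ℕ.* v G k j))

  In-ℚ₊B-intro : (x : Point ℚ n) (w : Fin n → ℚ) (b : Fin q → ℚ) (τ : ℚ) →
    (∀ j → 0ℚ ℚ.≤ w j) → (∀ k → 0ℚ ℚ.≤ b k) → sumℚ w ℚ.≤ τ →
    x ≈P ((λ j → w j ℚ.+ edgeSumℚ G b j) , τ ℚ.+ sumℚ b) → In-ℚ₊B G x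
  In-ℚ₊B-intro x w b τ 0≤w 0≤b ∑w≤τ (x-coord , x-last) =
    w , b , τ ℚ.- sumℚ w , 0≤w , 0≤b , p≤q⇒0≤q-p ∑w≤τ ,
    (λ j → trans (combℚ-coord w b (τ ℚ.- sumℚ w) j) (sym (x-coord j))) ,
    trans (combℚ-last w b (τ ℚ.- sumℚ w))
      (trans (solve 3 (λ W B t → (W :+ B) :+ (t :- W) := t :+ B) refl (sumℚ w) (sumℚ b) τ) (sym x-last))

  In-Interior-intro : (x : Point ℚ n) (p : Fin n → ℚ) (b : Fin q → ℚ) (τ s : ℚ) →
    0ℚ ℚ.< s → (∀ j → s ℚ.≤ p j) → (∀ k → 0ℚ ℚ.≤ b k) → sumℚ p ℚ.+ s ℚ.≤ τ →
    x ≈P ((λ j → p j ℚ.+ edgeSumℚ G b j) , τ ℚ.+ sumℚ b) → In-Interior G x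
  In-Interior-intro x p b τ s 0<s s≤p 0≤b margin (x-coord , x-last) = ε , 0<ε , perturbation
    where
    ε : ℚ
    ε = s ℚ.* recip n

    0<ε : 0ℚ ℚ.< ε
    0<ε = ℚ.positive⁻¹ ε {{ℚ.pos*pos⇒pos s {{ℚ.positive 0<s}} (recip n) {{ℚ.positive (0<recip n)}}}}

    ε+nε≡s : ε ℚ.+ fromℕ n ℚ.* ε ≡ s
    ε+nε≡s = begin
      ε ℚ.+ fromℕ n ℚ.* ε
        ≡⟨ solve 3 (λ s r x → s :* r :+ x :* (s :* r) := s :* (r :+ r :* x)) refl s (recip n) (fromℕ n) ⟩
      s ℚ.* (recip n ℚ.+ recip n ℚ.* fromℕ n)
        ≡⟨ cong (s ℚ.*_) (recip+recip*k≡1 n) ⟩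
      s ℚ.* 1ℚ
        ≡⟨ ℚ.*-identityʳ s ⟩
      s ∎
      where open ≡-Reasoning

    ε≤s : ε ℚ.≤ s
    ε≤s = ℚ.≤-trans (p≤p+q (0≤p*q (0≤fromℕ n) (ℚ.<⇒≤ 0<ε))) (ℚ.≤-reflexive ε+nε≡s)

    move-last : ∀ a b c → (a ℚ.+ b) ℚ.+ c ≡ (a ℚ.+ c) ℚ.+ b
    move-last = solve 3 (λ a b c → (a :+ b) :+ c := (a :+ c) :+ b) refl

    perturbation : (y : Point ℚ n) → (∀ j → ∣ proj₁ y j ∣ ℚ.< ε) → ∣ proj₂ y ∣ ℚ.< ε → In-ℚ₊B G (x +Q y)
    perturbation (y , y′) ∣y∣<ε ∣y′∣<ε =
      In-ℚ₊B-intro (x +Q (y , y′)) (λ j → p j ℚ.+ y j) b (τ ℚ.+ y′) 0≤p+y 0≤b ∑p+y≤τ+y′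
        ((λ j → trans (cong (ℚ._+ y j) (x-coord j)) (move-last (p j) _ (y j))) ,
         trans (cong (ℚ._+ y′) x-last) (move-last τ _ y′))
      where
      0≤p+y : ∀ j → 0ℚ ℚ.≤ p j ℚ.+ y j
      0≤p+y j = subst (ℚ._≤ p j ℚ.+ y j) (ℚ.+-inverseʳ ε)
        (ℚ.+-mono-≤ (ℚ.≤-trans ε≤s (s≤p j)) (∣p∣≤q⇒-q≤p (ℚ.<⇒≤ (∣y∣<ε j))))

      ∑p+y≤τ+y′ : sumℚ (λ j → p j ℚ.+ y j) ℚ.≤ τ ℚ.+ y′
      ∑p+y≤τ+y′ = begin
        sumℚ (λ j → p j ℚ.+ y j)
          ≡⟨ ℚΣ.∑-distrib-+ p y ⟩
        sumℚ p ℚ.+ sumℚ y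
          ≤⟨ ℚ.+-monoʳ-≤ (sumℚ p) (sumℚ≤fromℕ* y ε (λ j → ℚ.≤-trans (p≤∣p∣ (y j)) (ℚ.<⇒≤ (∣y∣<ε j)))) ⟩
        sumℚ p ℚ.+ fromℕ n ℚ.* ε
          ≡⟨ solve 3 (λ P e x → P :+ x :* e := (P :+ (e :+ x :* e)) :- e) refl (sumℚ p) ε (fromℕ n) ⟩
        (sumℚ p ℚ.+ (ε ℚ.+ fromℕ n ℚ.* ε)) ℚ.- ε
          ≡⟨ cong (λ z → (sumℚ p ℚ.+ z) ℚ.- ε) ε+nε≡s ⟩
        (sumℚ p ℚ.+ s) ℚ.- ε
          ≤⟨ ℚ.+-monoˡ-≤ (ℚ.- ε) margin ⟩
        τ ℚ.- ε
          ≤⟨ ℚ.+-monoʳ-≤ τ (∣p∣≤q⇒-q≤p (ℚ.<⇒≤ ∣y′∣<ε)) ⟩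
        τ ℚ.+ y′ ∎
        where open ℚ.≤-Reasoning

  positive⇒In-Interior : (x : Point ℕ n) (a : Fin n → ℕ) (m : Fin q → ℕ) (c : ℕ) →
    combℕ G a m c ≈P x → 1 ≤ c → (∀ j → 1 ≤ proj₁ x j) → In-Interior G (toℚP x)
  positive⇒In-Interior (u , t) a m c (comb-coord , comb-last) 1≤c 1≤u =
    In-Interior-intro (toℚP (u , t)) p b τ s (0<recip S) s≤p 0≤b margin (coord , last)
    where
    V : Fin n → ℕ
    V = edgeSumℕ G m
    S : ℕ
    S = sumℕ V
    -- s′ = 1 - s by recip+recip*k≡1.
    s s′ : ℚ
    s  = recip S
    s′ = s ℚ.* fromℕ S
    0≤s : 0ℚ ℚ.≤ s
    0≤s = ℚ.<⇒≤ (0<recip S)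
    s≤1 : s ℚ.≤ 1ℚ
    s≤1 = ℚ.≤-trans (p≤p+q (0≤p*q 0≤s (0≤fromℕ S))) (ℚ.≤-reflexive (recip+recip*k≡1 S))

    p : Fin n → ℚ
    p j = fromℕ (a j) ℚ.+ s ℚ.* fromℕ (V j)
    b : Fin q → ℚ
    b k = s′ ℚ.* fromℕ (m k)
    τ : ℚ
    τ = (fromℕ (sumℕ a) ℚ.+ s ℚ.* fromℕ (sumℕ m)) ℚ.+ fromℕ c

    u≡a+V : ∀ j → u j ≡ a j ℕ.+ V j
    u≡a+V j = trans (sym (comb-coord j)) (combℕ-coord a m c j)

    split : ∀ A B → fromℕ (A ℕ.+ B) ≡ (fromℕ A ℚ.+ s ℚ.* fromℕ B) ℚ.+ s′ ℚ.* fromℕ B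
    split A B = begin
      fromℕ (A ℕ.+ B)
        ≡⟨ fromℕ-homo-+ A B ⟩
      fromℕ A ℚ.+ fromℕ B
        ≡⟨ cong (fromℕ A ℚ.+_) (ℚ.*-identityˡ (fromℕ B)) ⟨
      fromℕ A ℚ.+ 1ℚ ℚ.* fromℕ B
        ≡⟨ cong (λ z → fromℕ A ℚ.+ z ℚ.* fromℕ B) (recip+recip*k≡1 S) ⟨
      fromℕ A ℚ.+ (s ℚ.+ s′) ℚ.* fromℕ B
        ≡⟨ solve 4 (λ A B s s′ → A :+ (s :+ s′) :* B := (A :+ s :* B) :+ s′ :* B) refl (fromℕ A) (fromℕ B) s s′ ⟩
      (fromℕ A ℚ.+ s ℚ.* fromℕ B) ℚ.+ s′ ℚ.* fromℕ B ∎
      where open ≡-Reasoning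

    coord : ∀ j → fromℕ (u j) ≡ p j ℚ.+ edgeSumℚ G b j
    coord j = trans (cong fromℕ (u≡a+V j)) (trans (split (a j) (V j)) (cong (p j ℚ.+_) (sym (edgeSumℚ-fromℕ s′ m j))))

    last : fromℕ t ≡ τ ℚ.+ sumℚ b
    last = begin
      fromℕ t
        ≡⟨ cong fromℕ (trans (sym comb-last) (combℕ-last a m c)) ⟩
      fromℕ ((sumℕ a ℕ.+ sumℕ m) ℕ.+ c)
        ≡⟨ fromℕ-homo-+ (sumℕ a ℕ.+ sumℕ m) c ⟩
      fromℕ (sumℕ a ℕ.+ sumℕ m) ℚ.+ fromℕ c
        ≡⟨ cong (ℚ._+ fromℕ c) (split (sumℕ a) (sumℕ m)) ⟩
      (fromℕ (sumℕ a) ℚ.+ s ℚ.* fromℕ (sumℕ m) ℚ.+ s′ ℚ.* fromℕ (sumℕ m)) ℚ.+ fromℕ c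
        ≡⟨ solve 3 (λ X Y Z → (X :+ Y) :+ Z := (X :+ Z) :+ Y) refl (fromℕ (sumℕ a) ℚ.+ s ℚ.* fromℕ (sumℕ m)) _ (fromℕ c) ⟩
      τ ℚ.+ s′ ℚ.* fromℕ (sumℕ m)
        ≡⟨ cong (τ ℚ.+_) (sum-scaled-fromℕ s′ m) ⟨
      τ ℚ.+ sumℚ b ∎
      where open ≡-Reasoning

    s≤p : ∀ j → s ℚ.≤ p j
    s≤p j = begin
      s
        ≡⟨ ℚ.*-identityʳ s ⟨
      s ℚ.* 1ℚ
        ≤⟨ ℚ.*-monoˡ-≤-nonNeg s {{ℚ.nonNegative 0≤s}} (fromℕ-mono-≤ (1≤u j)) ⟩
      s ℚ.* fromℕ (u j)
        ≡⟨ cong (λ z → s ℚ.* fromℕ z) (u≡a+V j) ⟩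
      s ℚ.* fromℕ (a j ℕ.+ V j)
        ≡⟨ cong (s ℚ.*_) (fromℕ-homo-+ (a j) (V j)) ⟩
      s ℚ.* (fromℕ (a j) ℚ.+ fromℕ (V j))
        ≡⟨ ℚ.*-distribˡ-+ s (fromℕ (a j)) (fromℕ (V j)) ⟩
      s ℚ.* fromℕ (a j) ℚ.+ s ℚ.* fromℕ (V j)
        ≤⟨ ℚ.+-monoˡ-≤ (s ℚ.* fromℕ (V j)) (p≤1⇒p*q≤q (0≤fromℕ (a j)) s≤1) ⟩
      p j ∎
      where open ℚ.≤-Reasoning

    0≤b : ∀ k → 0ℚ ℚ.≤ b k
    0≤b k = 0≤p*q (0≤p*q 0≤s (0≤fromℕ S)) (0≤fromℕ (m k))

    margin : sumℚ p ℚ.+ s ℚ.≤ τ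
    margin = begin
      sumℚ p ℚ.+ s
        ≡⟨ cong (ℚ._+ s) (ℚΣ.∑-distrib-+ (fromℕ ∘ a) (λ j → s ℚ.* fromℕ (V j))) ⟩
      (sumℚ (fromℕ ∘ a) ℚ.+ sumℚ (λ j → s ℚ.* fromℕ (V j))) ℚ.+ s
        ≡⟨ cong₂ (λ X Y → (X ℚ.+ Y) ℚ.+ s) (sym (fromℕ-sum a)) (sum-scaled-fromℕ s V) ⟩
      (fromℕ (sumℕ a) ℚ.+ s ℚ.* fromℕ S) ℚ.+ s
        ≡⟨ solve 3 (λ A s x → (A :+ s :* x) :+ s := A :+ (s :+ s :* x)) refl (fromℕ (sumℕ a)) s (fromℕ S) ⟩
      fromℕ (sumℕ a) ℚ.+ (s ℚ.+ s′)
        ≡⟨ cong (fromℕ (sumℕ a) ℚ.+_) (recip+recip*k≡1 S) ⟩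
      fromℕ (sumℕ a) ℚ.+ 1ℚ
        ≤⟨ ℚ.+-monoʳ-≤ (fromℕ (sumℕ a)) (fromℕ-mono-≤ 1≤c) ⟩
      fromℕ (sumℕ a) ℚ.+ fromℕ c
        ≤⟨ ℚ.+-monoˡ-≤ (fromℕ c) (p≤p+q {fromℕ (sumℕ a)} (0≤p*q 0≤s (0≤fromℕ (sumℕ m)))) ⟩
      τ ∎
      where open ℚ.≤-Reasoning

module _ {n q : ℕ} (G : Graph n q) (C : Fin n → Bool) (r : Fin n → Fin q) where

  outside : Fin n → Bool
  outside j = not (C j) ∧ not (inW G C r j)

  vertexPart : Fin n → ℕ
  vertexPart = 𝟙 ∘ outside

  edgePart : Fin q → ℕ
  edgePart = pushforward r (𝟙 ∘ C)

  ẽ-coord : ∀ j → proj₁ (ẽ G C r) j ≡ sumℕ (λ i → 𝟙 (C i) ℕ.* v G (r i) j) ℕ.+ 𝟙 (outside j)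
  ẽ-coord j = trans
    (cong₂ (λ X Y → (X ℕ.+ Y) ℕ.+ 0)
      (trans (ΣP-coord n _ j) (ℕΣ.sum-cong-≗ (λ i → proj₁-if (C i) (vB G (r i)) j)))
      (trans (ΣP-coord n _ j) (trans (ℕΣ.sum-cong-≗ (λ i → proj₁-if (outside i) (eB i) j)) (sumℕ-δ (𝟙 ∘ outside) j))))
    (ℕ.+-identityʳ _)

  ẽ-last : proj₂ (ẽ G C r) ≡ (sumℕ (𝟙 ∘ C) ℕ.+ sumℕ (𝟙 ∘ outside)) ℕ.+ 1
  ẽ-last = cong (ℕ._+ 1) (cong₂ ℕ._+_
    (trans (ΣP-last n _) (ℕΣ.sum-cong-≗ (λ i → trans (proj₂-if (C i) (vB G (r i))) (ℕ.*-identityʳ (𝟙 (C i))))))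
    (trans (ΣP-last n _) (ℕΣ.sum-cong-≗ (λ i → trans (proj₂-if (outside i) (eB i)) (ℕ.*-identityʳ (𝟙 (outside i)))))))

  ẽ-decomposition : combℕ G vertexPart edgePart 1 ≈P ẽ G C r
  ẽ-decomposition = coord , last
    where
    coord : ∀ j → proj₁ (combℕ G vertexPart edgePart 1) j ≡ proj₁ (ẽ G C r) j
    coord j = begin
      proj₁ (combℕ G vertexPart edgePart 1) j
        ≡⟨ combℕ-coord G vertexPart edgePart 1 j ⟩
      𝟙 (outside j) ℕ.+ edgeSumℕ G edgePart j
        ≡⟨ cong (𝟙 (outside j) ℕ.+_) (sum-pushforward r (𝟙 ∘ C) (λ k → v G k j)) ⟩
      𝟙 (outside j) ℕ.+ sumℕ (λ i → 𝟙 (C i) ℕ.* v G (r i) j)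
        ≡⟨ ℕ.+-comm (𝟙 (outside j)) _ ⟩
      sumℕ (λ i → 𝟙 (C i) ℕ.* v G (r i) j) ℕ.+ 𝟙 (outside j)
        ≡⟨ ẽ-coord j ⟨
      proj₁ (ẽ G C r) j ∎
      where open ≡-Reasoning

    last : proj₂ (combℕ G vertexPart edgePart 1) ≡ proj₂ (ẽ G C r)
    last = begin
      proj₂ (combℕ G vertexPart edgePart 1)
        ≡⟨ combℕ-last G vertexPart edgePart 1 ⟩
      (sumℕ (𝟙 ∘ outside) ℕ.+ sumℕ edgePart) ℕ.+ 1
        ≡⟨ cong (λ X → (sumℕ (𝟙 ∘ outside) ℕ.+ X) ℕ.+ 1) (sum-pushforward-total r (𝟙 ∘ C)) ⟩
      (sumℕ (𝟙 ∘ outside) ℕ.+ sumℕ (𝟙 ∘ C)) ℕ.+ 1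
        ≡⟨ cong (ℕ._+ 1) (ℕ.+-comm (sumℕ (𝟙 ∘ outside)) _) ⟩
      (sumℕ (𝟙 ∘ C) ℕ.+ sumℕ (𝟙 ∘ outside)) ℕ.+ 1
        ≡⟨ ẽ-last ⟨
      proj₂ (ẽ G C r) ∎
      where open ≡-Reasoning

  1≤ẽ-coord : (∀ i → C i ≡ true → (i ∈E G) (r i)) → ∀ j → 1 ≤ proj₁ (ẽ G C r) j
  1≤ẽ-coord chosen j = subst (1 ≤_) (sym (ẽ-coord j)) (positive j)
    where
    covered : ∀ i j → C i ≡ true → 1 ≤ v G (r i) j → 1 ≤ sumℕ (λ i → 𝟙 (C i) ℕ.* v G (r i) j)
    covered i j ci 1≤v = ℕ.≤-trans 1≤v (ℕ.≤-trans
      (ℕ.≤-reflexive (sym (trans (cong (λ b → 𝟙 b ℕ.* v G (r i) j) ci) (ℕ.*-identityˡ _))))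
      (sumℕ-term≤ (λ i → 𝟙 (C i) ℕ.* v G (r i) j) i))

    positive : ∀ j → 1 ≤ sumℕ (λ i → 𝟙 (C i) ℕ.* v G (r i) j) ℕ.+ 𝟙 (outside j)
    positive j with C j in cj
    ... | true = ℕ.≤-trans (covered j j cj (∈E⇒1≤v G (chosen j cj))) (ℕ.m≤m+n _ _)
    ... | false with anyFin n (λ i → C i ∧ inc G (r i) j) in any
    ...   | false = ℕ.m≤n+m 1 _   -- here 𝟙 (outside j) computes to 1
    ...   | true with anyFin-true n _ any
    ...     | i , ci∧inc = ℕ.≤-trans
                (covered i j (proj₁ (∧-true⁻ ci∧inc)) (inc⇒1≤v G (proj₂ (∧-true⁻ ci∧inc))))
                (ℕ.m≤m+n _ _)

proposition3p11 : {n q : ℕ} (G : Graph n q) → IsSimple G → IsConnected G → q ≥ 1 →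
    (C : Fin n → Bool) → IsMinimalVertexCover G C →
    (r : Fin n → Fin q) →
    (∀ i → C i ≡ true → (i ∈E G) (r i) × (∀ j → (j ∈E G) (r i) → C j ≡ true → j ≡ i)) →
    In-ℕB G (ẽ G C r) × In-Interior G (toℚP (ẽ G C r))
proposition3p11 G _ _ _ C _ r chosen =
  (vertexPart G C r , edgePart G C r , 1 , ẽ-decomposition G C r) ,
  positive⇒In-Interior G (ẽ G C r) (vertexPart G C r) (edgePart G C r) 1 (ẽ-decomposition G C r) ℕ.≤-refl
    (1≤ẽ-coord G C r (λ i ci → proj₁ (chosen i ci)))
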